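{- Every graph in $\varepsilon_0$ has at least one vertex of degree $2$.
   Context: All graphs are finite, simple, undirected and connected. An Euler graph is a connected graph in which every vertex has even degree. $\varepsilon_0$ denotes the class of Euler graphs $G$ such that every cycle of $G$ has length $n\equiv 0 \pmod 4$. -}

module Defs where

open import Data.Nat using (ℕ; zero; suc; _+_; _≥_; _%_)
open import Data.Nat.Divisibility using (_∣_)
open import Data.Fin using (Fin; zero; suc; inject₁; fromℕ)
open import Data.Bool using (Bool; true; false; if_then_else_)
open import Data.List using (List; map; allFin)
open import Data.Nat.ListAction using (sum)
open import Data.Product using (Σ; _×_)
open import Function.Definitions using (Injective)
open import Relation.Binary.PropositionalEquality using (_≡_)

record Graph (n : ℕ) : Set where
  field
    adj    : Fin n → Fin n → Bool
    sym    : ∀ u v → adj u v ≡ adj v u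
    irrefl : ∀ v → adj v v ≡ false
open Graph public

degree : ∀ {n} → Graph n → Fin n → ℕ
degree G v = sum (map (λ u → if adj G v u then 1 else 0) (allFin _))

data Walk {n : ℕ} (G : Graph n) : Fin n → Fin n → Set where
  here : ∀ {v} → Walk G v v
  step : ∀ {u w v} → adj G u w ≡ true → Walk G w v → Walk G u v

Connected : ∀ {n} → Graph n → Set
Connected G = ∀ u v → Walk G u v

IsEuler : ∀ {n} → Graph n → Set
IsEuler G = Connected G × (∀ v → 2 ∣ degree G v)

record Cycle {n : ℕ} (G : Graph n) (m : ℕ) : Set where
  field
    vert   : Fin (3 + m) → Fin n
    inj    : Injective _≡_ _≡_ vert
    edges  : ∀ (i : Fin (2 + m)) → adj G (vert (inject₁ i)) (vert (suc i)) ≡ true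
    closed : adj G (vert (fromℕ (2 + m))) (vert zero) ≡ true

cycleLength : ∀ {n} {G : Graph n} {m} → Cycle G m → ℕ
cycleLength {m = m} _ = 3 + m

InEps0 : ∀ {n} → Graph n → Set
InEps0 G = IsEuler G × (∀ m (C : Cycle G m) → 4 ∣ cycleLength C)

-- Take a path p 0, p 1, …, p (l - 1) that cannot be extended beyond p 0, so that every
-- neighbour of p 0 lies on it. Two neighbours p a, p b with 2 ≤ a < b would close the
-- cycles p 0 … p a, p 0 … p b and p 0 p a … p b, of lengths a + 1, b + 1 and b - a + 2;
-- the first and third add up to the second plus 2, so they cannot all be divisible by 4.
-- Hence p 0 has at most two neighbours, p 1 and one p a; it has at least one because the
-- graph is connected and has two vertices, and it has an even number of them.
module Submission where

open import Defs hiding (sym)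
open import Data.Bool using (Bool; true; false; if_then_else_)
open import Data.Bool.Properties using () renaming (_≟_ to _≟ᵇ_)
open import Data.Empty using (⊥; ⊥-elim)
open import Data.Fin as Fin using (Fin; toℕ; punchIn)
open import Data.Fin.Properties
  using (_≟_; any?; injective⇒≤; toℕ-injective; toℕ<n; toℕ-inject₁; toℕ-fromℕ; punchInᵢ≢i)
open import Data.List using (List; []; _∷_; _++_; length; map; filter; allFin)
open import Data.List.Properties using (length-++)
open import Data.List.Membership.Propositional using (_∈_)
open import Data.List.Membership.Propositional.Properties
  using (∈-∃++; ∈-++⁻; ∈-++⁺ˡ; ∈-++⁺ʳ; ∈-filter⁺; ∈-filter⁻; ∈-allFin)
open import Data.List.Relation.Binary.Subset.Propositional using (_⊆_)
open import Data.List.Relation.Unary.Any using (here; there)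
open import Data.List.Relation.Unary.All as All using ()
open import Data.List.Relation.Unary.AllPairs using ([]; _∷_)
open import Data.List.Relation.Unary.Unique.Propositional using (Unique)
open import Data.List.Relation.Unary.Unique.Propositional.Properties using (filter⁺; allFin⁺)
open import Data.Nat using (ℕ; zero; suc; _+_; _≤_; _<_; _≥_; _≤?_; z≤n; s≤s)
open import Data.Nat.Divisibility using (_∣_; divides; ∣m∣n⇒∣m+n; ∣m+n∣m⇒∣n)
open import Data.Nat.ListAction using (sum)
open import Data.Nat.Properties
  using (≤-trans; <-trans; <⇒≤; n≤1+n; 1+n≰n; +-suc; +-identityʳ; +-monoʳ-<; +-cancelˡ-≡;
         <-cmp; m≤n⇒∃[o]m+o≡n; anyUpTo?; module ≤-Reasoning)
open import Data.Nat.Solver using (module +-*-Solver)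
open import Data.Product using (∃; _×_; _,_; proj₁; proj₂)
open import Data.Sum using (inj₁; inj₂)
open import Function using (_∘_; case_of_)
open import Relation.Binary.Definitions using (tri<; tri≈; tri>)
open import Relation.Binary.PropositionalEquality
  using (_≡_; _≢_; refl; sym; trans; cong; subst)
open import Relation.Nullary using (¬_; Dec; yes; no; contradiction)
open import Relation.Nullary.Decidable using (_×-dec_; ¬?; decidable-stable)

Unique-⊆⇒length≤ : ∀ {A : Set} {xs ys : List A} → Unique xs → xs ⊆ ys → length xs ≤ length ys
Unique-⊆⇒length≤ [] _ = z≤n
Unique-⊆⇒length≤ {xs = x ∷ xs} (x≢xs ∷ xs!) x∷xs⊆ys
  with ys₁ , ys₂ , refl ← ∈-∃++ (x∷xs⊆ys (here refl)) = begin
    suc (length xs)                 ≤⟨ s≤s (Unique-⊆⇒length≤ xs! xs⊆ys₁++ys₂) ⟩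
    suc (length (ys₁ ++ ys₂))       ≡⟨ cong suc (length-++ ys₁) ⟩
    suc (length ys₁ + length ys₂)   ≡⟨ sym (+-suc (length ys₁) (length ys₂)) ⟩
    length ys₁ + length (x ∷ ys₂)   ≡⟨ sym (length-++ ys₁) ⟩
    length (ys₁ ++ x ∷ ys₂)         ∎
  where
  open ≤-Reasoning
  xs⊆ys₁++ys₂ : xs ⊆ ys₁ ++ ys₂
  xs⊆ys₁++ys₂ z∈xs with ∈-++⁻ ys₁ (x∷xs⊆ys (there z∈xs))
  ... | inj₁ z∈ys₁         = ∈-++⁺ˡ z∈ys₁
  ... | inj₂ (here refl)   = contradiction refl (All.lookup x≢xs z∈xs)
  ... | inj₂ (there z∈ys₂) = ∈-++⁺ʳ ys₁ z∈ys₂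

sum-indicator≡length-filter : ∀ {A : Set} (b : A → Bool) (xs : List A) →
  sum (map (λ x → if b x then 1 else 0) xs) ≡ length (filter (λ x → b x ≟ᵇ true) xs)
sum-indicator≡length-filter b [] = refl
sum-indicator≡length-filter b (x ∷ xs) with b x
... | true  = cong suc (sum-indicator≡length-filter b xs)
... | false = sum-indicator≡length-filter b xs

2∣n⇒0<n⇒n≤2⇒n≡2 : ∀ {n} → 2 ∣ n → 0 < n → n ≤ 2 → n ≡ 2
2∣n⇒0<n⇒n≤2⇒n≡2 (divides zero refl)          ()
2∣n⇒0<n⇒n≤2⇒n≡2 (divides (suc zero) refl)    _ _ = refl
2∣n⇒0<n⇒n≤2⇒n≡2 (divides (suc (suc _)) refl) _ (s≤s (s≤s ()))

4∤2 : ¬ 4 ∣ 2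
4∤2 (divides zero ())
4∤2 (divides (suc _) ())

[1+a]+[3+d]≡[2+a+d]+2 : ∀ a d → suc a + (3 + d) ≡ suc (suc a + d) + 2
[1+a]+[3+d]≡[2+a+d]+2 = solve 2 (λ a d → (con 1 :+ a) :+ (con 3 :+ d) := (con 2 :+ (a :+ d)) :+ con 2)
                                refl
  where open +-*-Solver

_◂_ : ∀ {A : Set} → A → (ℕ → A) → ℕ → A
(x ◂ f) zero    = x
(x ◂ f) (suc i) = f i

module _ {n : ℕ} (G : Graph n) where

  neighbours : Fin n → List (Fin n)
  neighbours v = filter (λ u → adj G v u ≟ᵇ true) (allFin n)

  degree≡length-neighbours : ∀ v → degree G v ≡ length (neighbours v)
  degree≡length-neighbours v = sum-indicator≡length-filter (adj G v) (allFin n)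

  degree≤length : ∀ {v} {S : List (Fin n)} → (∀ {u} → adj G v u ≡ true → u ∈ S) →
                  degree G v ≤ length S
  degree≤length {v} {S} N⊆S = begin
    degree G v              ≡⟨ degree≡length-neighbours v ⟩
    length (neighbours v)   ≤⟨ Unique-⊆⇒length≤ (filter⁺ _ (allFin⁺ n)) N⊆S′ ⟩
    length S                ∎
    where
    open ≤-Reasoning
    N⊆S′ : neighbours v ⊆ S
    N⊆S′ = N⊆S ∘ proj₂ ∘ ∈-filter⁻ (λ u → adj G v u ≟ᵇ true) {xs = allFin n}

  adj⇒0<degree : ∀ {u v} → adj G v u ≡ true → 0 < degree G v
  adj⇒0<degree {u} {v} e = begin
    1                       ≤⟨ Unique-⊆⇒length≤ (All.[] ∷ []) (λ { (here refl) → u∈N }) ⟩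
    length (neighbours v)   ≡⟨ sym (degree≡length-neighbours v) ⟩
    degree G v              ∎
    where
    open ≤-Reasoning
    u∈N : u ∈ neighbours v
    u∈N = ∈-filter⁺ _ (∈-allFin u) e

  adj-sym : ∀ {u v} → adj G u v ≡ true → adj G v u ≡ true
  adj-sym {u} {v} = trans (Graph.sym G v u)

  adj⇒≢ : ∀ {u v} → adj G u v ≡ true → u ≢ v
  adj⇒≢ {u} e refl with () ← trans (sym (irrefl G u)) e

  walk⇒adj : ∀ {u v} → Walk G u v → u ≢ v → ∃ λ w → adj G u w ≡ true
  walk⇒adj here       u≢u = contradiction refl u≢u
  walk⇒adj (step e _) _   = _ , e

  -- A path with the l vertices p 0, …, p (l - 1); the values of p beyond are irrelevant.
  record IsPath (p : ℕ → Fin n) (l : ℕ) : Set where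
    field
      injective : ∀ {i j} → i < l → j < l → p i ≡ p j → i ≡ j
      adjacent  : ∀ {i} → suc i < l → adj G (p i) (p (suc i)) ≡ true
  open IsPath

  module _ {p : ℕ → Fin n} {l : ℕ} (P : IsPath p l) where

    vertices : Fin l → Fin n
    vertices i = p (toℕ i)

    vertices-injective : ∀ {i j} → vertices i ≡ vertices j → i ≡ j
    vertices-injective {i} {j} eq = toℕ-injective (injective P (toℕ<n i) (toℕ<n j) eq)

    length≤order : l ≤ n
    length≤order = injective⇒≤ vertices-injective

    take : ∀ {k} → k ≤ l → IsPath p k
    take k≤l = record
      { injective = λ i<k j<k → injective P (≤-trans i<k k≤l) (≤-trans j<k k≤l)
      ; adjacent  = λ i+1<k → adjacent P (≤-trans i+1<k k≤l)
      }

    cons : ∀ {u} → adj G u (p 0) ≡ true → (∀ {i} → i < l → p i ≢ u) → IsPath (u ◂ p) (suc l)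
    cons {u} e u∉p = record { injective = injective′ ; adjacent = adjacent′ }
      where
      injective′ : ∀ {i j} → i < suc l → j < suc l → (u ◂ p) i ≡ (u ◂ p) j → i ≡ j
      injective′ {zero}  {zero}  _         _         _  = refl
      injective′ {zero}  {suc j} _         (s≤s j<l) eq = contradiction (sym eq) (u∉p j<l)
      injective′ {suc i} {zero}  (s≤s i<l) _         eq = contradiction eq (u∉p i<l)
      injective′ {suc i} {suc j} (s≤s i<l) (s≤s j<l) eq = cong suc (injective P i<l j<l eq)
      adjacent′ : ∀ {i} → suc i < suc l → adj G ((u ◂ p) i) ((u ◂ p) (suc i)) ≡ true
      adjacent′ {zero}  _             = e
      adjacent′ {suc i} (s≤s i+1<l) = adjacent P i+1<l

  drop : ∀ {p l} a → IsPath p (a + l) → IsPath (λ j → p (a + j)) l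
  drop {p} {l} a P = record { injective = injective′ ; adjacent = adjacent′ }
    where
    injective′ : ∀ {i j} → i < l → j < l → p (a + i) ≡ p (a + j) → i ≡ j
    injective′ i<l j<l eq = +-cancelˡ-≡ a _ _ (injective P (+-monoʳ-< a i<l) (+-monoʳ-< a j<l) eq)
    adjacent′ : ∀ {i} → suc i < l → adj G (p (a + i)) (p (a + suc i)) ≡ true
    adjacent′ {i} i+1<l rewrite +-suc a i =
      adjacent P (subst (_< a + l) (+-suc a i) (+-monoʳ-< a i+1<l))

  close : ∀ {p m} → IsPath p (3 + m) → adj G (p (2 + m)) (p 0) ≡ true → Cycle G m
  close {p} {m} P closing = record
    { vert   = vertices P
    ; inj    = vertices-injective P
    ; edges  = λ i → subst (λ k → adj G (p k) (p (suc (toℕ i))) ≡ true) (sym (toℕ-inject₁ i))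
                           (adjacent P (s≤s (toℕ<n i)))
    ; closed = subst (λ k → adj G (p k) (p 0) ≡ true) (sym (toℕ-fromℕ (2 + m))) closing
    }

  OnPath : (ℕ → Fin n) → ℕ → Fin n → Set
  OnPath p l u = ∃ λ i → i < l × p i ≡ u

  onPath? : ∀ p l u → Dec (OnPath p l u)
  onPath? p l u = anyUpTo? (λ i → p i ≟ u) l

  record SaturatedPath : Set where
    field
      vert      : ℕ → Fin n
      len       : ℕ
      isPath    : IsPath vert len
      saturated : ∀ {u} → adj G (vert 0) u ≡ true → OnPath vert len u

  -- A path has at most n vertices, so it can be extended at most n ∸ l times.
  saturate : ∀ fuel {p l} → n ≤ l + fuel → IsPath p l → SaturatedPath
  saturate fuel {p} {l} n≤l+fuel P
    with any? (λ u → (adj G (p 0) u ≟ᵇ true) ×-dec ¬? (onPath? p l u))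
  ... | no none = record
    { vert = p ; len = l ; isPath = P
    ; saturated = λ {u} e → decidable-stable (onPath? p l u) (λ u∉p → none (u , e , u∉p))
    }
  ... | yes (u , e , u∉p) = continue fuel n≤l+fuel
    where
    P′ : IsPath (u ◂ p) (suc l)
    P′ = cons P (adj-sym e) (λ i<l eq → u∉p (_ , i<l , eq))
    continue : ∀ fuel → n ≤ l + fuel → SaturatedPath
    continue zero    n≤l+0   = contradiction (≤-trans (length≤order P′) (subst (n ≤_) (+-identityʳ l) n≤l+0))
                                             1+n≰n
    continue (suc f) n≤l+1+f = saturate f (subst (n ≤_) (+-suc l f) n≤l+1+f) P′

  saturated-path : Fin n → SaturatedPath
  saturated-path v = saturate n (n≤1+n n) single
    where
    single : IsPath (λ _ → v) 1
    single = record
      { injective = λ { (s≤s z≤n) (s≤s z≤n) _ → refl }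
      ; adjacent  = λ { (s≤s ()) }
      }

CyclesDivisibleBy4 : ∀ {n} → Graph n → Set
CyclesDivisibleBy4 G = ∀ m (C : Cycle G m) → 4 ∣ cycleLength C

module _ {n : ℕ} {G : Graph n} (cycles4 : CyclesDivisibleBy4 G)
         {p : ℕ → Fin n} {l : ℕ} (P : IsPath G p l) where

  open IsPath P

  chord-cycle : ∀ {a} → 2 ≤ a → a < l → adj G (p 0) (p a) ≡ true → 4 ∣ suc a
  chord-cycle {suc (suc m)} (s≤s (s≤s _)) a<l e = cycles4 m (close G (take G P a<l) (adj-sym G e))

  shortcut : ∀ {a k} → 0 < a → a + k ≤ l → adj G (p 0) (p a) ≡ true →
             IsPath G (p 0 ◂ λ j → p (a + j)) (suc k)
  shortcut {a@(suc _)} {k} _ a+k≤l e = cons G (drop G a (take G P a+k≤l)) e′ p0∉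
    where
    e′ : adj G (p 0) (p (a + 0)) ≡ true
    e′ = subst (λ i → adj G (p 0) (p i) ≡ true) (sym (+-identityʳ a)) e
    p0∉ : ∀ {j} → j < k → p (a + j) ≢ p 0
    p0∉ j<k eq = case injective a+j<l (≤-trans (s≤s z≤n) a+j<l) eq of λ ()
      where
      a+j<l : a + _ < l
      a+j<l = ≤-trans (+-monoʳ-< a j<k) a+k≤l

  no-two-chords : ∀ {a b} → 2 ≤ a → a < b → b < l →
                  adj G (p 0) (p a) ≡ true → adj G (p 0) (p b) ≡ true → ⊥
  no-two-chords {a} 2≤a a<b b<l ea eb with d , refl ← m≤n⇒∃[o]m+o≡n a<b =
    4∤2 (∣m+n∣m⇒∣n (subst (4 ∣_) ([1+a]+[3+d]≡[2+a+d]+2 a d) (∣m∣n⇒∣m+n 4∣1+a 4∣3+d)) 4∣1+b)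
    where
    4∣1+a : 4 ∣ suc a
    4∣1+a = chord-cycle 2≤a (<-trans a<b b<l) ea
    4∣1+b : 4 ∣ suc (suc a + d)
    4∣1+b = chord-cycle (≤-trans 2≤a (<⇒≤ a<b)) b<l eb
    a+[2+d]≡1+b : a + suc (suc d) ≡ suc (suc a + d)
    a+[2+d]≡1+b = trans (+-suc a (suc d)) (cong suc (+-suc a d))
    Q : IsPath G (p 0 ◂ λ j → p (a + j)) (3 + d)
    Q = shortcut (≤-trans (s≤s z≤n) 2≤a) (subst (_≤ l) (sym a+[2+d]≡1+b) b<l) ea
    closing : adj G (p (a + suc d)) (p 0) ≡ true
    closing = subst (λ i → adj G (p i) (p 0) ≡ true) (sym (+-suc a d)) (adj-sym G eb)
    4∣3+d : 4 ∣ 3 + d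
    4∣3+d = cycles4 d (close G Q closing)

  chords-coincide : ∀ {a b} → 2 ≤ a → 2 ≤ b → a < l → b < l →
                    adj G (p 0) (p a) ≡ true → adj G (p 0) (p b) ≡ true → a ≡ b
  chords-coincide {a} {b} 2≤a 2≤b a<l b<l ea eb with <-cmp a b
  ... | tri< a<b _ _ = ⊥-elim (no-two-chords 2≤a a<b b<l ea eb)
  ... | tri≈ _ a≡b _ = a≡b
  ... | tri> _ _ b<a = ⊥-elim (no-two-chords 2≤b b<a a<l eb ea)

module _ {n : ℕ} {G : Graph n} (cycles4 : CyclesDivisibleBy4 G) (S : SaturatedPath G) where

  open SaturatedPath S

  chord-index : ∃ λ a → ∀ {i} → 2 ≤ i → i < len → adj G (vert 0) (vert i) ≡ true → i ≡ a
  chord-index with anyUpTo? (λ a → (2 ≤? a) ×-dec (adj G (vert 0) (vert a) ≟ᵇ true)) len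
  ... | yes (a , a<len , 2≤a , ea) =
    a , λ 2≤i i<len ei → chords-coincide cycles4 isPath 2≤i 2≤a i<len a<len ei ea
  ... | no no-chord =
    0 , λ 2≤i i<len ei → contradiction (_ , i<len , 2≤i , ei) no-chord

  neighbours-of-first : ∀ {u} → adj G (vert 0) u ≡ true → u ∈ vert 1 ∷ vert (proj₁ chord-index) ∷ []
  neighbours-of-first e with saturated e
  ... | zero        , _     , refl = contradiction refl (adj⇒≢ G e)
  ... | suc zero    , _     , refl = here refl
  ... | suc (suc _) , i<len , refl =
    there (here (cong vert (proj₂ chord-index (s≤s (s≤s z≤n)) i<len e)))

  degree-first≤2 : degree G (vert 0) ≤ 2
  degree-first≤2 = degree≤length G neighbours-of-first

theorem4 : ∀ {n : ℕ} (G : Graph n) → n ≥ 2 → InEps0 G →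
    ∃ λ (v : Fin n) → degree G v ≡ 2
theorem4 {suc (suc _)} G (s≤s (s≤s _)) ((connected , even) , cycles4) =
  v , 2∣n⇒0<n⇒n≤2⇒n≡2 (even v) (adj⇒0<degree G (proj₂ has-neighbour)) (degree-first≤2 cycles4 S)
  where
  S : SaturatedPath G
  S = saturated-path G Fin.zero
  v : Fin _
  v = SaturatedPath.vert S 0
  has-neighbour : ∃ λ u → adj G v u ≡ true
  has-neighbour = walk⇒adj G (connected v (punchIn v Fin.zero)) (punchInᵢ≢i v Fin.zero ∘ sym)
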